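{- Let $\Gamma$ be the geometry of the complete graph $K_v$ with $v\ge 3$. For a flag $(p,L)$ of $\Gamma$ let $\bar p$ denote the unique point of $L$ other than $p$. Then the map $\beta$ on the elements of the triangle complex $\Delta(\Gamma)$ given by $\beta((p,L,1))=(\bar p,L,1)$, $\beta((p,L,2))=(\bar p,L,3)$, $\beta((p,L,3))=(\bar p,L,2)$ is a duality of $\Delta(\Gamma)$.
   Context: The geometry of $K_v$ is the linear space whose points are the $v$ vertices of the complete graph and whose lines are its edges (each with exactly two points). Triangle complex: $\Delta(\Gamma)$ is the rank three incidence system over $\{1,2,3\}$ whose elements are the triples $(p,L,i)$ with $p$ incident with $L$ and $i\in\{1,2,3\}$; the type of $(p,L,i)$ is $i$; and $(p,L,i)$ is incident with $(p',L',i \bmod 3+1)$ if and only if the set of points incident with both $L$ and $L'$ is exactly $\{p\}$ and $p\neq p'$ (incidence symmetric and reflexive, no other incidences). A correlation is a bijection preserving incidence and sending elements of equal type to elements of equal type; a duality is a correlation of order $2$ inducing a transposition on the type set. -}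

module Defs where

open import Data.Nat using (ℕ; _≥_)
open import Data.Fin using (Fin; zero; suc; _<_)
open import Data.Fin.Properties using (_≟_)
open import Data.Product using (Σ; Σ-syntax; _×_; _,_; proj₁; proj₂; ∃-syntax)
open import Data.Sum using (_⊎_; inj₁; inj₂)
open import Relation.Binary.PropositionalEquality using (_≡_; _≢_; refl)
open import Relation.Nullary using (¬_; yes; no)
open import Function.Definitions using (Bijective)

-- Geometry of the complete graph K_v: points are Fin v, lines are the
-- 2-element subsets {a , b}, represented canonically as pairs with a < b.
Point : ℕ → Set
Point v = Fin v

Line : ℕ → Set
Line v = Σ[ a ∈ Fin v ] Σ[ b ∈ Fin v ] (a < b)

_I_ : ∀ {v} → Point v → Line v → Set
p I (a , b , _) = (p ≡ a) ⊎ (p ≡ b)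

Flag : ℕ → Set
Flag v = Σ[ p ∈ Point v ] Σ[ L ∈ Line v ] (p I L)

barFlag : ∀ {v} → Flag v → Flag v
barFlag (p , (a , b , a<b) , _) with p ≟ a
... | yes _ = b , (a , b , a<b) , inj₂ refl
... | no _ = a , (a , b , a<b) , inj₁ refl

bar : ∀ {v} → Flag v → Point v
bar F = proj₁ (barFlag F)

-- the types {1,2,3} are represented by Fin 3 as 0,1,2
Type : Set
Type = Fin 3

-- i ↦ (i mod 3) + 1, i.e. 1 ↦ 2 ↦ 3 ↦ 1
next : Type → Type
next zero = suc zero
next (suc zero) = suc (suc zero)
next (suc (suc zero)) = zero

Elem : ℕ → Set
Elem v = Flag v × Type

type : ∀ {v} → Elem v → Type
type (_ , i) = i

MeetExactly : ∀ {v} → Line v → Line v → Point v → Set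
MeetExactly {v} L L' p = (q : Point v) → ((q I L × q I L') → q ≡ p) × (q ≡ p → (q I L × q I L'))

Adj : ∀ {v} → Elem v → Elem v → Set
Adj ((p , L , _) , i) ((p' , L' , _) , j) = (j ≡ next i) × MeetExactly L L' p × (p ≢ p')

Inc : ∀ {v} → Elem v → Elem v → Set
Inc x y = (x ≡ y) ⊎ Adj x y ⊎ Adj y x

IsCorrelation : ∀ {v} → (Elem v → Elem v) → Set
IsCorrelation {v} f =
  Bijective _≡_ _≡_ f
  × ((x y : Elem v) → (Inc x y → Inc (f x) (f y)) × (Inc (f x) (f y) → Inc x y))
  × ((x y : Elem v) → (type x ≡ type y → type (f x) ≡ type (f y)) × (type (f x) ≡ type (f y) → type x ≡ type y))

IsTransposition : (Type → Type) → Set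
IsTransposition σ = Σ[ i ∈ Type ] Σ[ j ∈ Type ]
  (i ≢ j) × (σ i ≡ j) × (σ j ≡ i) × ((k : Type) → k ≢ i → k ≢ j → σ k ≡ k)

IsDuality : ∀ {v} → (Elem v → Elem v) → Set
IsDuality {v} f =
  IsCorrelation f
  × ((x : Elem v) → f (f x) ≡ x)
  × (Σ[ x ∈ Elem v ] f x ≢ x)
  × (Σ[ σ ∈ (Type → Type) ] ((x : Elem v) → type (f x) ≡ σ (type x)) × IsTransposition σ)

β : ∀ {v} → Elem v → Elem v
β (F , zero) = barFlag F , zero
β (F , suc zero) = barFlag F , suc (suc zero)
β (F , suc (suc zero)) = barFlag F , suc zero

{-# OPTIONS --safe #-}
-- Every line of K_v has exactly two points, so p ↦ p̄ is a fixed-point-free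
-- involution on flags. If (p,L,i) is incident with (p',L',i+1), then p lies on
-- L' and differs from p', hence p = p̄'; therefore L' ∩ L = {p̄'} and p̄' ≠ p̄.
-- With σ the transposition of the types 2 and 3, for which σ i = σ(i+1) + 1,
-- this says that (p̄',L',σ(i+1)) is incident with (p̄,L,σ i): β reverses the
-- oriented incidence. Being an involution, β then reflects incidence as well.
-- The hypothesis v ≥ 3 is only needed, as v ≥ 2, for Δ(Γ) to be nonempty.
module Submission where

open import Defs
open import Algebra.Definitions using (Involutive)
open import Data.Nat using (ℕ; _≥_; s≤s; z≤n)
open import Data.Nat.Properties using (<⇒≤)
open import Data.Fin using (zero; suc; _<_)
open import Data.Fin.Properties using (_≟_; <⇒≢)
open import Data.Product using (_,_; proj₁; proj₂; swap)
open import Data.Sum using (_⊎_; inj₁; inj₂)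
open import Function using (_∘_)
open import Function.Bundles using (Bijection; mk↔ₛ′)
open import Function.Properties.Inverse using (↔⇒⤖)
open import Relation.Binary using (Rel)
open import Relation.Binary.PropositionalEquality using (_≡_; _≢_; refl; sym; trans; cong; subst; subst₂)
open import Relation.Nullary using (yes; no; contradiction)

involution⇒reflects : ∀ {a ℓ} {A : Set a} (R : Rel A ℓ) {f : A → A} → Involutive _≡_ f →
                      (∀ {x y} → R x y → R (f x) (f y)) → ∀ {x y} → R (f x) (f y) → R x y
involution⇒reflects R f-inv f-pres {x} {y} = subst₂ R (f-inv x) (f-inv y) ∘ f-pres

involution⇒correlation : ∀ {v} {f : Elem v → Elem v} (τ : Type → Type) → Involutive _≡_ f →
                         (∀ {x y} → Inc x y → Inc (f x) (f y)) → (∀ x → type (f x) ≡ τ (type x)) →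
                         IsCorrelation f
involution⇒correlation {f = f} τ f-inv Inc-pres type-f =
  Bijection.bijective (↔⇒⤖ (mk↔ₛ′ f f f-inv f-inv))
  , (λ _ _ → Inc-pres , involution⇒reflects Inc f-inv Inc-pres)
  , (λ _ _ → type-pres , involution⇒reflects (λ x y → type x ≡ type y) f-inv type-pres)
  where
  type-pres : ∀ {x y} → type x ≡ type y → type (f x) ≡ type (f y)
  type-pres {x} {y} eq = trans (type-f x) (trans (cong τ eq) (sym (type-f y)))

σ : Type → Type
σ zero = zero
σ (suc zero) = suc (suc zero)
σ (suc (suc zero)) = suc zero

σ-reverses-next : ∀ {i j} → j ≡ next i → σ i ≡ next (σ j)
σ-reverses-next {zero} refl = refl
σ-reverses-next {suc zero} refl = refl
σ-reverses-next {suc (suc zero)} refl = refl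

σ-transposition : IsTransposition σ
σ-transposition = suc zero , suc (suc zero) , (λ ()) , refl , refl , fixes-rest
  where
  fixes-rest : ∀ k → k ≢ suc zero → k ≢ suc (suc zero) → σ k ≡ k
  fixes-rest zero _ _ = refl
  fixes-rest (suc zero) k≢2 _ = contradiction refl k≢2
  fixes-rest (suc (suc zero)) _ k≢3 = contradiction refl k≢3

module _ {v : ℕ} where

  point : Flag v → Point v
  point = proj₁

  line : Flag v → Line v
  line = proj₁ ∘ proj₂

  barFlag-first : ∀ {a b : Point v} (a<b : a < b) →
                  barFlag (a , (a , b , a<b) , inj₁ refl) ≡ (b , (a , b , a<b) , inj₂ refl)
  barFlag-first {a} _ with a ≟ a
  ... | yes _ = refl
  ... | no a≢a = contradiction refl a≢a

  barFlag-second : ∀ {a b : Point v} (a<b : a < b) →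
                   barFlag (b , (a , b , a<b) , inj₂ refl) ≡ (a , (a , b , a<b) , inj₁ refl)
  barFlag-second {a} {b} a<b with b ≟ a
  ... | yes b≡a = contradiction (sym b≡a) (<⇒≢ a<b)
  ... | no _ = refl

  line-barFlag : (F : Flag v) → line (barFlag F) ≡ line F
  line-barFlag (p , (a , _ , _) , _) with p ≟ a
  ... | yes _ = refl
  ... | no _ = refl

  barFlag-involutive : Involutive _≡_ (barFlag {v})
  barFlag-involutive (_ , (_ , _ , a<b) , inj₁ refl) =
    trans (cong barFlag (barFlag-first a<b)) (barFlag-second a<b)
  barFlag-involutive (_ , (_ , _ , a<b) , inj₂ refl) =
    trans (cong barFlag (barFlag-second a<b)) (barFlag-first a<b)

  bar≢point : (F : Flag v) → bar F ≢ point F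
  bar≢point (_ , (_ , _ , a<b) , inj₁ refl) b≡a =
    <⇒≢ a<b (trans (sym b≡a) (cong proj₁ (barFlag-first a<b)))
  bar≢point (_ , (_ , _ , a<b) , inj₂ refl) a≡b =
    <⇒≢ a<b (trans (sym (cong proj₁ (barFlag-second a<b))) a≡b)

  point⊎bar : (F : Flag v) {r : Point v} → r I line F → r ≡ point F ⊎ r ≡ bar F
  point⊎bar (_ , (_ , _ , a<b) , inj₁ refl) (inj₁ r≡a) = inj₁ r≡a
  point⊎bar (_ , (_ , _ , a<b) , inj₁ refl) (inj₂ r≡b) =
    inj₂ (trans r≡b (sym (cong proj₁ (barFlag-first a<b))))
  point⊎bar (_ , (_ , _ , a<b) , inj₂ refl) (inj₁ r≡a) =
    inj₂ (trans r≡a (sym (cong proj₁ (barFlag-second a<b))))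
  point⊎bar (_ , (_ , _ , a<b) , inj₂ refl) (inj₂ r≡b) = inj₁ r≡b

  MeetExactly-sym : ∀ {L L' : Line v} {p} → MeetExactly L L' p → MeetExactly L' L p
  MeetExactly-sym L∩L'≡p q = proj₁ (L∩L'≡p q) ∘ swap , swap ∘ proj₂ (L∩L'≡p q)

  MeetExactly⇒≡bar : ∀ {L : Line v} {p} (G : Flag v) → MeetExactly L (line G) p → p ≢ point G → p ≡ bar G
  MeetExactly⇒≡bar {p = p} G L∩L'≡p p≢p' with point⊎bar G (proj₂ (proj₂ (L∩L'≡p p) refl))
  ... | inj₁ p≡p' = contradiction p≡p' p≢p'
  ... | inj₂ p≡p̄' = p≡p̄'

  β-def : (F : Flag v) (i : Type) → β (F , i) ≡ (barFlag F , σ i)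
  β-def F zero = refl
  β-def F (suc zero) = refl
  β-def F (suc (suc zero)) = refl

  β-type : (x : Elem v) → type (β x) ≡ σ (type x)
  β-type (F , i) = cong proj₂ (β-def F i)

  β-involutive : Involutive _≡_ (β {v})
  β-involutive (F , zero) = cong (_, zero) (barFlag-involutive F)
  β-involutive (F , suc zero) = cong (_, suc zero) (barFlag-involutive F)
  β-involutive (F , suc (suc zero)) = cong (_, suc (suc zero)) (barFlag-involutive F)

  β-fixed-point-free : (x : Elem v) → β x ≢ x
  β-fixed-point-free (F , i) βx≡x = bar≢point F (cong (point ∘ proj₁) (trans (sym (β-def F i)) βx≡x))

  Adj-barFlag : ∀ {F G : Flag v} {i j} → Adj (F , i) (G , j) → Adj (barFlag G , σ j) (barFlag F , σ i)
  Adj-barFlag {F} {G} {i} (j≡next-i , L∩L'≡p , p≢p') =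
    σ-reverses-next {i} j≡next-i
    , subst₂ (λ L' L → MeetExactly L' L (bar G)) (sym (line-barFlag G)) (sym (line-barFlag F))
        (subst (MeetExactly (line G) (line F)) p≡p̄' (MeetExactly-sym {L = line F} {line G} L∩L'≡p))
    , (λ p̄'≡p̄ → bar≢point F (trans (sym p̄'≡p̄) (sym p≡p̄')))
    where
    p≡p̄' : point F ≡ bar G
    p≡p̄' = MeetExactly⇒≡bar {L = line F} G L∩L'≡p p≢p'

  Adj-β : ∀ {x y : Elem v} → Adj x y → Adj (β y) (β x)
  Adj-β {F , i} {G , j} adj =
    subst₂ Adj (sym (β-def G j)) (sym (β-def F i)) (Adj-barFlag {F = F} {G} {i} {j} adj)

  Inc-β : ∀ {x y : Elem v} → Inc x y → Inc (β x) (β y)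
  Inc-β (inj₁ refl) = inj₁ refl
  Inc-β (inj₂ (inj₁ adj)) = inj₂ (inj₂ (Adj-β adj))
  Inc-β (inj₂ (inj₂ adj)) = inj₂ (inj₁ (Adj-β adj))

anElement : ∀ {v} → v ≥ 2 → Elem v
anElement (s≤s (s≤s _)) = (zero , (zero , suc zero , s≤s z≤n) , inj₁ refl) , zero

lemma3p13 : (v : ℕ) → v ≥ 3 → IsDuality (β {v})
lemma3p13 v v≥3 =
  involution⇒correlation σ β-involutive Inc-β β-type
  , β-involutive
  , (anElement (<⇒≤ v≥3) , β-fixed-point-free (anElement (<⇒≤ v≥3)))
  , (σ , β-type , σ-transposition)
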